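{- Let $P=(P_0,\dots,P_L)$ be a hierarchical partition of degree $c$, equipped with a good ordering of its cells, and let $C_1,C_2$ be cells. Then the number of boundary cells of the range $[C_1,C_2]$ is at most $2(c-1)L$.
   Context: A hierarchical partition $P=(P_0,\dots,P_L)$ of a set $S$ is a sequence of partitions with $P_L=\{S\}$ and $P_{\ell-1}$ refining $P_\ell$; the children of $C\in P_\ell$ are the cells of $P_{\ell-1}$ contained in $C$; siblings are children of the same cell; the degree is the maximum number of children of a cell. A good ordering is a total order on all cells of all levels such that for every $\ell$ and $C,C'\in P_\ell$ with $C<C'$, every child of $C$ precedes every child of $C'$. For cells $C_1,C_2$, $[C_1,C_2]=\{C:C_1\le C\le C_2\}$, and $C\in[C_1,C_2]$ is a boundary cell if some sibling of $C$ is not in $[C_1,C_2]$. -}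

module Defs where

open import Level using (0ℓ)
open import Data.Nat using (ℕ; suc; _≤_)
open import Data.Fin using (Fin; toℕ; fromℕ)
open import Data.Product using (Σ; ∃; _×_; _,_; proj₁; proj₂)
open import Data.List using (List; length)
open import Data.List.Relation.Unary.All using (All)
open import Data.List.Relation.Unary.Unique.Propositional using (Unique)
open import Relation.Unary using (Pred; _∈_; _∉_; _⊆_; Satisfiable)
open import Relation.Binary using (Rel)
open import Relation.Binary.PropositionalEquality using (_≡_; _≢_)

-- "the number of elements of A satisfying P is at most n":
-- every duplicate-free list of elements satisfying P has length ≤ n.
AtMost : {A : Set} → ℕ → Pred A 0ℓ → Set
AtMost {A} n P = (xs : List A) → Unique xs → All P xs → length xs ≤ n

AtLeast : {A : Set} → ℕ → Pred A 0ℓ → Set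
AtLeast {A} n P = Σ (List A) λ xs → Unique xs × All P xs × length xs ≡ n

record IsPartition (S : Set) (k : ℕ) (cell : Fin k → Pred S 0ℓ) : Set where
  field
    nonempty : ∀ i → Satisfiable (cell i)
    cover    : ∀ x → ∃ λ i → x ∈ cell i
    disjoint : ∀ i j x → x ∈ cell i → x ∈ cell j → i ≡ j

record HierarchicalPartition (S : Set) (L : ℕ) : Set₁ where
  field
    size        : Fin (suc L) → ℕ
    cell        : (ℓ : Fin (suc L)) → Fin (size ℓ) → Pred S 0ℓ
    isPartition : ∀ ℓ → IsPartition S (size ℓ) (cell ℓ)
    top-size    : size (fromℕ L) ≡ 1
    top-all     : ∀ i x → x ∈ cell (fromℕ L) i
    -- P_{ℓ-1} refines P_ℓ
    refines     : ∀ ℓ ℓ' → suc (toℕ ℓ') ≡ toℕ ℓ →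
                  ∀ j → ∃ λ i → cell ℓ' j ⊆ cell ℓ i

module _ {S : Set} {L : ℕ} (H : HierarchicalPartition S L) where
  open HierarchicalPartition H

  Cell : Set
  Cell = Σ (Fin (suc L)) λ ℓ → Fin (size ℓ)

  level : Cell → Fin (suc L)
  level = proj₁

  subset : Cell → Pred S 0ℓ
  subset (ℓ , i) = cell ℓ i

  ChildOf : Cell → Cell → Set
  ChildOf D C = suc (toℕ (level D)) ≡ toℕ (level C) × subset D ⊆ subset C

  Siblings : Cell → Cell → Set
  Siblings D D' = ∃ λ C → ChildOf D C × ChildOf D' C

  HasDegree : ℕ → Set
  HasDegree c = (∀ C → AtMost c (λ D → ChildOf D C))
              × (∃ λ C → AtLeast c (λ D → ChildOf D C))

  module _ (_≼_ : Rel Cell 0ℓ) where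

    _≺_ : Rel Cell 0ℓ
    C ≺ C' = C ≼ C' × C ≢ C'

    IsGoodOrdering : Set
    IsGoodOrdering = ∀ C C' D D' → level C ≡ level C' → C ≺ C' →
                     ChildOf D C → ChildOf D' C' → D ≺ D'

    Range : Cell → Cell → Pred Cell 0ℓ
    Range C₁ C₂ C = C₁ ≼ C × C ≼ C₂

    IsBoundaryCell : Cell → Cell → Pred Cell 0ℓ
    IsBoundaryCell C₁ C₂ C =
      C ∈ Range C₁ C₂ × ∃ λ C' → Siblings C C' × C' ∉ Range C₁ C₂

-- A boundary cell C of [C₁, C₂] has a parent P and a sibling C' outside the range, lying either
-- before C₁ or after C₂. Two boundary cells on the same level whose outside siblings lie on the
-- same side have the same parent: otherwise the good ordering interleaves the two families of
-- children so that one outside sibling falls between C₁ and C₂. So on each of the L levels below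
-- the top and for each of the two sides, the boundary cells are children of one common parent
-- which also has a child outside the range, and there are at most c − 1 of them.
module Submission where

open import Defs
open import Level using (0ℓ)
open import Data.Nat using (ℕ; _*_; _∸_)
open import Relation.Binary using (Rel; IsTotalOrder)
open import Relation.Binary.PropositionalEquality using (_≡_)

open import Function using (_∘_)
open import Data.Empty using (⊥)
open import Data.Nat using (suc; _+_; _≤_; _<_; z≤n)
import Data.Nat as ℕ
open import Data.Nat.Properties using (+-mono-≤; +-suc; ≤-pred; ∸-monoˡ-≤; *-comm; module ≤-Reasoning)
import Data.Fin as Fin
open import Data.Fin.Properties using (toℕ<n; toℕ-injective)
open import Data.Product using (Σ; _×_; _,_; proj₁; proj₂)
open import Data.Bool using (true; false)
open import Data.Product.Properties using (≡-dec)
open import Data.Sum using (inj₁; inj₂)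
open import Data.List using (List; []; _∷_; length; map; filter; upTo)
open import Data.List.Properties using (length-map; length-upTo)
open import Data.List.Membership.Propositional using (_∈_)
open import Data.List.Membership.Propositional.Properties using (∈-upTo⁺)
open import Data.List.Relation.Unary.Any using (here; there)
open import Data.List.Relation.Unary.All as All using (All; []; _∷_)
open import Data.List.Relation.Unary.All.Properties using (all-filter; filter⁺; map⁺)
open import Data.List.Relation.Unary.AllPairs using (AllPairs; []; _∷_)
open import Data.List.Relation.Unary.Unique.Propositional using (Unique)
open import Data.List.Relation.Binary.Sublist.Propositional using (_⊆_; []; _∷_; _∷ʳ_; ⊆-trans)
import Data.List.Relation.Binary.Sublist.Propositional.Properties as Sublist
open import Relation.Binary.Definitions using (DecidableEquality)
open import Relation.Binary.PropositionalEquality using (_≢_; refl; sym; trans; cong; subst)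
open import Relation.Nullary using (¬_; does; yes; no; contradiction)
open import Relation.Nullary.Decidable using (decidable-stable)
open import Relation.Unary using (Pred; Decidable; _∉_)
open import Relation.Unary.Properties using (∁?)

length-filter+filter-∁ : {A : Set} {P : Pred A 0ℓ} (P? : Decidable P) (xs : List A) →
  length (filter P? xs) + length (filter (∁? P?) xs) ≡ length xs
length-filter+filter-∁ P? [] = refl
length-filter+filter-∁ P? (x ∷ xs) with does (P? x)
... | true  = cong suc (length-filter+filter-∁ P? xs)
... | false = trans (+-suc _ _) (cong suc (length-filter+filter-∁ P? xs))

AllPairs-resp-⊇ : {A : Set} {R : Rel A 0ℓ} {ws ys : List A} → ws ⊆ ys → AllPairs R ys → AllPairs R ws
AllPairs-resp-⊇ []             []       = []
AllPairs-resp-⊇ (_ ∷ʳ ws⊆ys)   (_ ∷ rs) = AllPairs-resp-⊇ ws⊆ys rs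
AllPairs-resp-⊇ (refl ∷ ws⊆ys) (r ∷ rs) = Sublist.All-resp-⊆ ws⊆ys r ∷ AllPairs-resp-⊇ ws⊆ys rs

∈-∷-≢ : {B : Set} {x k : B} {ks : List B} → x ∈ k ∷ ks → x ≢ k → x ∈ ks
∈-∷-≢ (here x≡k) x≢k = contradiction x≡k x≢k
∈-∷-≢ (there x∈ks) _ = x∈ks

length-≤-classes*size : {A B : Set} (_≟_ : DecidableEquality B) (class : A → B) {m : ℕ} →
  (ks : List B) (ys : List A) → All (λ y → class y ∈ ks) ys →
  (∀ k {ws} → ws ⊆ ys → All (λ w → class w ≡ k) ws → length ws ≤ m) →
  length ys ≤ length ks * m
length-≤-classes*size _≟_ class [] [] _ _ = z≤n
length-≤-classes*size _≟_ class [] (_ ∷ _) (() ∷ _) _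
length-≤-classes*size _≟_ class {m} (k ∷ ks) ys inClasses size = begin
    length ys
  ≡⟨ sym (length-filter+filter-∁ isK? ys) ⟩
    length (filter isK? ys) + length others
  ≤⟨ +-mono-≤ (size k (Sublist.filter-⊆ isK? ys) (all-filter isK? ys))
              (length-≤-classes*size _≟_ class ks others othersInClasses othersSize) ⟩
    m + length ks * m
  ∎
  where
  open ≤-Reasoning
  isK? : Decidable (λ y → class y ≡ k)
  isK? y = class y ≟ k
  others : List _
  others = filter (∁? isK?) ys
  othersInClasses : All (λ y → class y ∈ ks) others
  othersInClasses = All.zipWith (λ (∈k∷ks , ≢k) → ∈-∷-≢ ∈k∷ks ≢k)
                                (filter⁺ (∁? isK?) inClasses , all-filter (∁? isK?) ys)
  othersSize : ∀ k' {ws} → ws ⊆ others → All (λ w → class w ≡ k') ws → length ws ≤ m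
  othersSize k' ws⊆others = size k' (⊆-trans ws⊆others (Sublist.filter-⊆ (∁? isK?) ys))

module _ {A : Set} {_≼_ : Rel A 0ℓ} (tot : IsTotalOrder _≡_ _≼_) (_≟_ : DecidableEquality A) where
  open IsTotalOrder tot using (total)

  ≮∧≯⇒≡ : ∀ {x y} → ¬ (x ≼ y × x ≢ y) → ¬ (y ≼ x × y ≢ x) → x ≡ y
  ≮∧≯⇒≡ {x} {y} x≮y y≮x with total x y
  ... | inj₁ x≼y = decidable-stable (x ≟ y) (λ x≢y → x≮y (x≼y , x≢y))
  ... | inj₂ y≼x = decidable-stable (x ≟ y) (λ x≢y → y≮x (y≼x , x≢y ∘ sym))

module BoundaryCells {S : Set} {L : ℕ} (H : HierarchicalPartition S L)
  (_≼_ : Rel (Cell H) 0ℓ) (tot : IsTotalOrder _≡_ _≼_) (good : IsGoodOrdering H _≼_)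
  (C₁ C₂ : Cell H) where

  open IsTotalOrder tot using (total) renaming (trans to ≼-trans)

  InRange : Pred (Cell H) 0ℓ
  InRange = Range H _≼_ C₁ C₂

  BoundaryCell : Set
  BoundaryCell = Σ (Cell H) (IsBoundaryCell H _≼_ C₁ C₂)

  cell parent sibling : BoundaryCell → Cell H
  cell = proj₁
  parent  (_ , _ , _ , (P , _) , _) = P
  sibling (_ , _ , C' , _) = C'

  cell-child : ∀ b → ChildOf H (cell b) (parent b)
  cell-child (_ , _ , _ , (_ , C◃P , _) , _) = C◃P

  sibling-child : ∀ b → ChildOf H (sibling b) (parent b)
  sibling-child (_ , _ , _ , (_ , _ , C'◃P) , _) = C'◃P

  cell-inRange : ∀ b → InRange (cell b)
  cell-inRange (_ , C∈ , _) = C∈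

  sibling-∉ : ∀ b → sibling b ∉ InRange
  sibling-∉ (_ , _ , _ , _ , C'∉) = C'∉

  sibling≢cell : ∀ b b' → sibling b ≢ cell b'
  sibling≢cell b b' eq = sibling-∉ b (subst InRange (sym eq) (cell-inRange b'))

  depth : BoundaryCell → ℕ
  depth b = Fin.toℕ (level H (cell b))

  depth<L : ∀ b → depth b < L
  depth<L b = subst (_≤ L) (sym (proj₁ (cell-child b))) (≤-pred (toℕ<n (level H (parent b))))

  data Side : Set where
    before after : Side

  _≟ˢ_ : DecidableEquality Side
  before ≟ˢ before = yes refl
  after  ≟ˢ after  = yes refl
  before ≟ˢ after  = no λ ()
  after  ≟ˢ before = no λ ()

  ∈-sides : ∀ s → s ∈ before ∷ after ∷ []
  ∈-sides before = here refl
  ∈-sides after  = there (here refl)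

  Outside : Side → Pred (Cell H) 0ℓ
  Outside before C = ¬ C₁ ≼ C
  Outside after  C = ¬ C ≼ C₂

  ∉InRange⇒Outside : ∀ {C} → C₁ ≼ C₂ → C ∉ InRange → Σ Side (λ s → Outside s C)
  ∉InRange⇒Outside {C} C₁≼C₂ C∉ with total C₁ C
  ... | inj₁ C₁≼C = after , λ C≼C₂ → C∉ (C₁≼C , C≼C₂)
  ... | inj₂ C≼C₁ = before , λ C₁≼C → C∉ (C₁≼C , ≼-trans C≼C₁ C₁≼C₂)

  sidedSibling : ∀ b → Σ Side (λ s → Outside s (sibling b))
  sidedSibling b = ∉InRange⇒Outside (≼-trans C₁≼C C≼C₂) (sibling-∉ b)
    where
    C₁≼C = proj₁ (cell-inRange b)
    C≼C₂ = proj₂ (cell-inRange b)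

  side : BoundaryCell → Side
  side = proj₁ ∘ sidedSibling

  sibling-outside : ∀ b → Outside (side b) (sibling b)
  sibling-outside = proj₂ ∘ sidedSibling

  interleaved-outside : ∀ s {C C' D D'} → InRange C → InRange C' → C ≼ D' → D ≼ C' →
    Outside s D → Outside s D' → ⊥
  interleaved-outside before C∈ _   C≼D' _    _  D'out = D'out (≼-trans (proj₁ C∈) C≼D')
  interleaved-outside after  _  C'∈ _    D≼C' Dout _   = Dout (≼-trans D≼C' (proj₂ C'∈))

  sameClass⇒parent⊀parent : ∀ b b' → depth b ≡ depth b' → side b ≡ side b' →
    ¬ _≺_ H _≼_ (parent b) (parent b')
  sameClass⇒parent⊀parent b b' sameDepth sameSide P≺P' =
    interleaved-outside (side b) (cell-inRange b) (cell-inRange b')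
      (proj₁ (good _ _ _ _ sameLevel P≺P' (cell-child b) (sibling-child b')))
      (proj₁ (good _ _ _ _ sameLevel P≺P' (sibling-child b) (cell-child b')))
      (sibling-outside b)
      (subst (λ s → Outside s (sibling b')) (sym sameSide) (sibling-outside b'))
    where
    sameLevel : level H (parent b) ≡ level H (parent b')
    sameLevel = toℕ-injective
      (trans (sym (proj₁ (cell-child b))) (trans (cong suc sameDepth) (proj₁ (cell-child b'))))

  sameClass⇒sameParent : ∀ b b' → depth b ≡ depth b' → side b ≡ side b' → parent b ≡ parent b'
  sameClass⇒sameParent b b' sameDepth sameSide = ≮∧≯⇒≡ tot (≡-dec Fin._≟_ Fin._≟_)
    (sameClass⇒parent⊀parent b b' sameDepth sameSide)
    (sameClass⇒parent⊀parent b' b (sym sameDepth) (sym sameSide))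

  module _ {c : ℕ} (degree : ∀ C → AtMost c (λ D → ChildOf H D C)) where

    class-size : ∀ {i s} (ws : List BoundaryCell) → Unique (map cell ws) →
      All (λ w → depth w ≡ i) ws → All (λ w → side w ≡ s) ws → length ws ≤ c ∸ 1
    class-size [] _ _ _ = z≤n
    class-size {i} {s} ws@(w ∷ _) distinct depths@(dw ∷ _) sides@(sw ∷ _) =
      subst (_≤ c ∸ 1) (length-map cell ws)
        (∸-monoˡ-≤ 1 (degree (parent w) (sibling w ∷ map cell ws)
                             (siblingIsNew ∷ distinct) (sibling-child w ∷ children)))
      where
      siblingIsNew : All (sibling w ≢_) (map cell ws)
      siblingIsNew = map⁺ {xs = ws} (All.tabulate λ {v} _ → sibling≢cell w v)
      childOfParent : ∀ {v} → depth v ≡ i × side v ≡ s → ChildOf H (cell v) (parent w)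
      childOfParent {v} (dv , sv) = subst (ChildOf H (cell v))
        (sameClass⇒sameParent v w (trans dv (sym dw)) (trans sv (sym sw))) (cell-child v)
      children : All (λ D → ChildOf H D (parent w)) (map cell ws)
      children = map⁺ {xs = ws} (All.zipWith (λ {v} → childOfParent {v}) (depths , sides))

    level-size : ∀ {i} (ws : List BoundaryCell) → Unique (map cell ws) →
      All (λ w → depth w ≡ i) ws → length ws ≤ 2 * (c ∸ 1)
    level-size ws distinct depths =
      length-≤-classes*size _≟ˢ_ side (before ∷ after ∷ []) ws (All.tabulate λ {w} _ → ∈-sides (side w))
        λ s vs⊆ws sides → class-size {s = s} _ (AllPairs-resp-⊇ (Sublist.map⁺ cell vs⊆ws) distinct)
                                       (Sublist.All-resp-⊆ vs⊆ws depths) sides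

    boundary-size : (ws : List BoundaryCell) → Unique (map cell ws) → length ws ≤ L * (2 * (c ∸ 1))
    boundary-size ws distinct = subst (λ n → length ws ≤ n * (2 * (c ∸ 1))) (length-upTo L)
      (length-≤-classes*size ℕ._≟_ depth (upTo L) ws (All.tabulate λ {w} _ → ∈-upTo⁺ (depth<L w))
        λ i vs⊆ws → level-size _ (AllPairs-resp-⊇ (Sublist.map⁺ cell vs⊆ws) distinct))

map-proj₁-toList : {A : Set} {P : Pred A 0ℓ} {xs : List A} (ps : All P xs) → map proj₁ (All.toList ps) ≡ xs
map-proj₁-toList [] = refl
map-proj₁-toList (p ∷ ps) = cong (_ ∷_) (map-proj₁-toList ps)

lemma5p1 : {S : Set} {L : ℕ} (H : HierarchicalPartition S L) (c : ℕ) →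
    HasDegree H c →
    (_≼_ : Rel (Cell H) 0ℓ) → IsTotalOrder _≡_ _≼_ → IsGoodOrdering H _≼_ →
    (C₁ C₂ : Cell H) →
    AtMost (2 * (c ∸ 1) * L) (IsBoundaryCell H _≼_ C₁ C₂)
lemma5p1 {L = L} H c (degree , _) _≼_ tot good C₁ C₂ xs distinct boundary = begin
    length xs                  ≡⟨ cong length (sym cells) ⟩
    length (map proj₁ ws)      ≡⟨ length-map proj₁ ws ⟩
    length ws                  ≤⟨ boundary-size degree ws (subst Unique (sym cells) distinct) ⟩
    L * (2 * (c ∸ 1))          ≡⟨ *-comm L _ ⟩
    2 * (c ∸ 1) * L            ∎
  where
  open BoundaryCells H _≼_ tot good C₁ C₂
  open ≤-Reasoning
  ws = All.toList boundary
  cells = map-proj₁-toList boundary
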